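{- No vector $(x_\alpha,\ldots,x_1)$ with $\alpha\ge2$ and $x_{\alpha-1}=1$ is realizable.
   Context: All graphs are finite, nonempty, simple and reflexive. Corner ranking: $N[v]$ is the closed neighborhood. In a graph $H$, $w$ strictly corners a distinct vertex $v$ if $N[v]\subsetneq N[w]$. Set $G^{(1)}=G$, $k=1$. If $G^{(k)}$ is a clique, give its vertices rank $k$ and stop; else if it has no strict corners, give its vertices rank $\infty$ and stop; else give all strict corners of $G^{(k)}$ rank $k$, delete them to get $G^{(k+1)}$, increase $k$, repeat. The corner rank $\alpha$ is the largest vertex rank; cop-win graphs are those with finite corner rank. The rank cardinality vector of $G$ is $(x_\alpha,\ldots,x_1)$, $x_k$ the number of vertices of rank $k$. A vector of positive integers is realizable if it is the rank cardinality vector of some cop-win graph. -}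

module Defs where

open import Data.Bool using (Bool; true; false; _∧_; _∨_; not; if_then_else_)
open import Data.Nat using (ℕ; zero; suc; _⊔_; _≡ᵇ_)
open import Data.Fin using (Fin)
open import Data.List using (List; []; _∷_; allFin; map; downFrom; foldr)
open import Data.Bool.ListAction using (all; any)
open import Data.Nat.ListAction using (sum)
open import Data.List.Relation.Unary.All using (All)
open import Data.Nat using (_>_)
open import Data.Product using (Σ; _×_; ∃)
open import Relation.Binary.PropositionalEquality using (_≡_)

record Graph (n : ℕ) : Set where
  field
    adj  : Fin n → Fin n → Bool
    sym  : ∀ u v → adj u v ≡ adj v u
    refl : ∀ v → adj v v ≡ true

open Graph public

-- A vertex subset (the currently surviving vertices), as a Boolean predicate.
VSet : ℕ → Set
VSet n = Fin n → Bool

_⇒ᵇ_ : Bool → Bool → Bool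
a ⇒ᵇ b = not a ∨ b

module _ {n : ℕ} (G : Graph n) where

  inN : VSet n → Fin n → Fin n → Bool
  inN S v u = S u ∧ adj G v u

  subN : VSet n → Fin n → Fin n → Bool
  subN S v w = all (λ u → inN S v u ⇒ᵇ inN S w u) (allFin n)

  strictSubN : VSet n → Fin n → Fin n → Bool
  strictSubN S v w = subN S v w ∧ not (subN S w v)

  isCorner : VSet n → Fin n → Bool
  isCorner S v = S v ∧ any (λ w → S w ∧ strictSubN S v w) (allFin n)

  isClique : VSet n → Bool
  isClique S = all (λ u → all (λ v → (S u ∧ S v) ⇒ᵇ adj G u v) (allFin n)) (allFin n)

  hasCorner : VSet n → Bool
  hasCorner S = any (isCorner S) (allFin n)

data Rank : Set where
  fin : ℕ → Rank
  ∞   : Rank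

module _ {n : ℕ} (G : Graph n) where

  -- rankFrom fuel k S v : the rank of v ∈ S when G^(k) is the induced subgraph on S.
  -- Each round deletes at least one vertex and never empties S, so fuel n suffices.
  rankFrom : ℕ → ℕ → VSet n → Fin n → Rank
  rankFrom zero k S v = ∞
  rankFrom (suc fuel) k S v =
    if isClique G S then fin k
    else if not (hasCorner G S) then ∞
    else if isCorner G S v then fin k
    else rankFrom fuel (suc k) (λ u → S u ∧ not (isCorner G S u)) v

  rank : Fin n → Rank
  rank v = rankFrom n 1 (λ _ → true) v

_⊔ʳ_ : Rank → Rank → Rank
fin a ⊔ʳ fin b = fin (a ⊔ b)
_     ⊔ʳ _     = ∞

cornerRank : ∀ {n} → Graph n → Rank
cornerRank {n} G = foldr (λ v r → rank G v ⊔ʳ r) (fin 0) (allFin n)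

isRank : Rank → ℕ → Bool
isRank (fin a) k = a ≡ᵇ k
isRank ∞       k = false

countRank : ∀ {n} → Graph n → ℕ → ℕ
countRank {n} G k = sum (map (λ v → if isRank (rank G v) k then 1 else 0) (allFin n))

-- rank cardinality vector (x_α, …, x_1) of a graph with finite corner rank α
rankCardinalityVector : ∀ {n} → Graph n → ℕ → List ℕ
rankCardinalityVector G α = map (λ j → countRank G (suc j)) (downFrom α)

-- A list of positive integers is realizable if it is the rank cardinality vector
-- of some cop-win (finite corner rank) finite nonempty graph.
Realizable : List ℕ → Set
Realizable xs =
  All (λ x → x > 0) xs ×
  Σ ℕ (λ n → Σ (Graph (suc n)) (λ G → Σ ℕ (λ α →
    (cornerRank G ≡ fin α) × (rankCardinalityVector G α ≡ xs))))

module Submission where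

-- Write K = α - 1 and let T be the vertex set of G^(K).  A vertex v₀ of
-- rank α survives to level K (`descend`), so T is not a clique and has
-- strict corners, all of which receive rank K (`corner-rank`); by x_K = 1
-- there is a single one, v.  Then
-- G^(K+1) = T - v is not a clique (`unique-corner-leaves-non-clique`):
-- otherwise the vertex w cornering v dominates all of T, and any vertex u
-- of T not adjacent to v would be a second corner.  But a non-clique
-- G^(K+1) always keeps a vertex of rank > K+1 = α, namely one of maximum
-- degree, which is never a strict corner (`non-clique-rank-exceeds`),
-- contradicting maximality of α.

open import Defs hiding (refl; sym)
open import Data.Nat using (ℕ)
open import Data.List using (List; _∷_)
open import Relation.Nullary using (¬_)

open import Data.Bool using (Bool; true; false; _∧_; not; if_then_else_)
  renaming (_≟_ to _≟ᵇ_)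
open import Data.Bool.Properties using (∧-conicalˡ; ∧-conicalʳ; T-≡; not-injective; not-¬; ¬-not)
open import Data.Nat using (zero; suc; _≤_; _<_; z≤n; s≤s)
open import Data.Nat.Properties
open import Data.Fin using (Fin) renaming (_≟_ to _≟ᶠ_)
open import Data.List using ([]; allFin; map; foldr; filter)
open import Data.List.Properties using (∷-injectiveˡ; ∷-injectiveʳ)
open import Data.List.Extrema.Nat using (argmax; argmax-all; f[xs]≤f[argmax])
open import Data.Bool.ListAction using (all; any)
open import Data.Nat.ListAction using (sum)
open import Data.List.Membership.Propositional using (_∈_)
open import Data.List.Membership.Propositional.Properties
  using (∈-allFin; ∈-filter⁺)
open import Data.List.Relation.Unary.Any as Any using (here; there; satisfied)
open import Data.List.Relation.Unary.Any.Properties using (any⁺; any⁻)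
import Data.List.Relation.Unary.All as All
open import Data.List.Relation.Unary.All.Properties
  using (all⁺; all⁻; all-filter)
open import Data.Product using (_×_; _,_; ∃; ∃₂; proj₁; proj₂)
open import Data.Sum using (inj₁; inj₂)
open import Data.Empty using (⊥)
open import Function using (Equivalence; _∘_)
open import Relation.Binary.PropositionalEquality
open import Relation.Nullary using (Dec; yes; no; contradiction)

open Equivalence using (to; from)

∧-intro : ∀ {a b} → a ≡ true → b ≡ true → a ∧ b ≡ true
∧-intro refl refl = refl

⇒-elim : ∀ {a b} → (a ⇒ᵇ b) ≡ true → a ≡ true → b ≡ true
⇒-elim {true} a⇒b refl = a⇒b

⇒-intro : ∀ {a b} → (a ≡ true → b ≡ true) → (a ⇒ᵇ b) ≡ true
⇒-intro {false} _ = refl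
⇒-intro {true}  f = f refl

⇒-false : ∀ {a b} → (a ⇒ᵇ b) ≡ false → a ≡ true × b ≡ false
⇒-false {true} {false} _ = refl , refl

indicator : Bool → ℕ
indicator b = if b then 1 else 0

indicator-mono : ∀ {a b} → (a ≡ true → b ≡ true) → indicator a ≤ indicator b
indicator-mono {false} _ = z≤n
indicator-mono {true}  f rewrite f refl = ≤-refl

module _ {n : ℕ} (p : Fin n → Bool) where

  all-elim : all p (allFin n) ≡ true → ∀ x → p x ≡ true
  all-elim h x = to T-≡ (All.lookup (all⁺ p (allFin n) (from T-≡ h)) (∈-allFin x))

  all-intro : (∀ x → p x ≡ true) → all p (allFin n) ≡ true
  all-intro h = to T-≡ (all⁻ p {allFin n} (All.tabulate (λ {x} _ → from T-≡ (h x))))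

  any-elim : any p (allFin n) ≡ true → ∃ λ x → p x ≡ true
  any-elim h with satisfied (any⁻ p (allFin n) (from T-≡ h))
  ... | x , px = x , to T-≡ px

  any-intro : ∀ x → p x ≡ true → any p (allFin n) ≡ true
  any-intro x px = to T-≡ (any⁺ p (Any.map (λ { refl → from T-≡ px }) (∈-allFin x)))

all-false : ∀ {A : Set} (p : A → Bool) (l : List A) → all p l ≡ false → ∃ λ x → p x ≡ false
all-false p (y ∷ l) h with p y in py
... | false = y , py
... | true  = all-false p l h

module _ {A : Set} (g h : A → ℕ) (g≤h : ∀ x → g x ≤ h x) where

  sum-map-mono : ∀ l → sum (map g l) ≤ sum (map h l)
  sum-map-mono []      = z≤n
  sum-map-mono (y ∷ l) = +-mono-≤ (g≤h y) (sum-map-mono l)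

  sum-map-strict : ∀ {l x} → x ∈ l → g x < h x → sum (map g l) < sum (map h l)
  sum-map-strict {y ∷ l} (here refl) lt = +-mono-<-≤ lt (sum-map-mono l)
  sum-map-strict {y ∷ l} (there x∈l) lt = +-mono-≤-< (g≤h y) (sum-map-strict x∈l lt)

module _ {A : Set} (g : A → ℕ) where

  ≤-sum : ∀ {l x} → x ∈ l → g x ≤ sum (map g l)
  ≤-sum {y ∷ l} (here refl) = m≤m+n (g y) _
  ≤-sum {y ∷ l} (there x∈l) = ≤-trans (≤-sum x∈l) (m≤n+m _ (g y))

  at-most-one-positive : ∀ {l x y} → sum (map g l) ≤ 1 → x ∈ l → y ∈ l →
                         0 < g x → 0 < g y → x ≡ y
  at-most-one-positive _ (here refl) (here refl) _ _ = refl
  at-most-one-positive {z ∷ l} s≤1 (here refl) (there y∈l) gz>0 gy>0 =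
    contradiction (≤-trans (+-mono-≤ gz>0 (≤-trans gy>0 (≤-sum y∈l))) s≤1) (λ { (s≤s ()) })
  at-most-one-positive {z ∷ l} s≤1 (there x∈l) (here refl) gx>0 gz>0 =
    contradiction (≤-trans (+-mono-≤ gz>0 (≤-trans gx>0 (≤-sum x∈l))) s≤1) (λ { (s≤s ()) })
  at-most-one-positive {z ∷ l} s≤1 (there x∈l) (there y∈l) =
    at-most-one-positive (≤-trans (m≤n+m _ (g z)) s≤1) x∈l y∈l

fin-injective : ∀ {a b} → fin a ≡ fin b → a ≡ b
fin-injective refl = refl

maxRank : ∀ {A : Set} → (A → Rank) → List A → Rank
maxRank f = foldr (λ v r → f v ⊔ʳ r) (fin 0)

maxRank-bounds : ∀ {A : Set} (f : A → Rank) l {α x} → maxRank f l ≡ fin α → x ∈ l →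
                 ∃ λ r → f x ≡ fin r × r ≤ α
maxRank-bounds f (y ∷ l) max≡α x∈l with f y in fy | maxRank f l in rest
maxRank-bounds f (y ∷ l) refl (here refl) | fin a | fin b = a , fy , m≤m⊔n a b
maxRank-bounds f (y ∷ l) refl (there x∈l) | fin a | fin b with maxRank-bounds f l rest x∈l
... | r , fx , r≤b = r , fx , ≤-trans r≤b (m≤n⊔m a b)
maxRank-bounds f (y ∷ l) () x∈l | fin a | ∞
maxRank-bounds f (y ∷ l) () x∈l | ∞ | _

maxRank-attained : ∀ {A : Set} (f : A → Rank) l {α} → maxRank f l ≡ fin (suc α) →
                   ∃ λ x → f x ≡ fin (suc α)
maxRank-attained f (y ∷ l) max≡α with f y in fy | maxRank f l in rest
maxRank-attained f (y ∷ l) max≡α | fin a | fin b with ⊔-sel a b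
... | inj₁ a⊔b≡a = y , trans fy (trans (cong fin (sym a⊔b≡a)) max≡α)
... | inj₂ a⊔b≡b = maxRank-attained f l (trans rest (trans (cong fin (sym a⊔b≡b)) max≡α))
maxRank-attained f (y ∷ l) () | fin a | ∞
maxRank-attained f (y ∷ l) () | ∞ | _

module Rounds {n : ℕ} (G : Graph n) where

  step : VSet n → VSet n
  step S u = S u ∧ not (isCorner G S u)

  clique-adj : ∀ {S x y} → isClique G S ≡ true → S x ≡ true → S y ≡ true → adj G x y ≡ true
  clique-adj {S} {x} {y} clique sx sy =
    ⇒-elim (all-elim _ (all-elim _ clique x) y) (∧-intro sx sy)

  non-clique-pair : ∀ {S} → isClique G S ≡ false →
                    ∃₂ λ a b → S a ≡ true × S b ≡ true × adj G a b ≡ false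
  non-clique-pair {S} notClique with all-false _ (allFin n) notClique
  ... | a , some-b with all-false _ (allFin n) some-b
  ...   | b , ¬ab with ⇒-false {S a ∧ S b} ¬ab
  ...     | sab , nonadj = a , b , ∧-conicalˡ _ _ sab , ∧-conicalʳ _ _ sab , nonadj

  ⊆N-elim : ∀ {S v w u} → subN G S v w ≡ true → inN G S v u ≡ true → inN G S w u ≡ true
  ⊆N-elim {u = u} v⊆w = ⇒-elim (all-elim _ v⊆w u)

  ⊆N-intro : ∀ {S v w} → (∀ u → inN G S v u ≡ true → inN G S w u ≡ true) → subN G S v w ≡ true
  ⊆N-intro {S} {v} f = all-intro _ (λ u → ⇒-intro {inN G S v u} (f u))

  ⊈N-witness : ∀ {S v w} → subN G S w v ≡ false →
               ∃ λ u → inN G S w u ≡ true × inN G S v u ≡ false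
  ⊈N-witness {S} {v} {w} w⊈v with all-false _ (allFin n) w⊈v
  ... | u , ¬wu⇒vu = u , ⇒-false {inN G S w u} ¬wu⇒vu

  record StrictlyCorners (S : VSet n) (w v : Fin n) : Set where
    field
      member : S w ≡ true
      below  : subN G S v w ≡ true
      proper : subN G S w v ≡ false

  corner-elim : ∀ {S v} → isCorner G S v ≡ true → S v ≡ true × ∃ λ w → StrictlyCorners S w v
  corner-elim {S} {v} corner with any-elim _ (∧-conicalʳ (S v) _ corner)
  ... | w , sw∧strict = ∧-conicalˡ _ _ corner ,
        w , record { member = ∧-conicalˡ _ _ sw∧strict
                   ; below  = ∧-conicalˡ _ _ strict
                   ; proper = not-injective (∧-conicalʳ _ _ strict) }
    where
    strict : strictSubN G S v w ≡ true
    strict = ∧-conicalʳ (S w) _ sw∧strict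

  corner-intro : ∀ {S v w} → S v ≡ true → StrictlyCorners S w v → isCorner G S v ≡ true
  corner-intro {S} {v} {w} sv c =
    ∧-intro sv (any-intro _ w (∧-intro member (∧-intro below (cong not proper))))
    where open StrictlyCorners c

  degree : VSet n → Fin n → ℕ
  degree S w = sum (map (indicator ∘ inN G S w) (allFin n))

  cornered-degree< : ∀ {S v w} → StrictlyCorners S w v → degree S v < degree S w
  cornered-degree< {S} {v} {w} c with ⊈N-witness {S} {v} {w} (StrictlyCorners.proper c)
  ... | u , wu , ¬vu =
    sum-map-strict _ _ pointwise (∈-allFin u)
      (subst₂ (λ a b → indicator a < indicator b) (sym ¬vu) (sym wu) (s≤s z≤n))
    where
    pointwise : ∀ x → indicator (inN G S v x) ≤ indicator (inN G S w x)
    pointwise x = indicator-mono (⊆N-elim {S} {v} {w} {x} (StrictlyCorners.below c))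

  max-degree-not-corner : ∀ {S w} → (∀ u → S u ≡ true → degree S u ≤ degree S w) →
                          isCorner G S w ≡ false
  max-degree-not-corner {S} {w} maximal with isCorner G S w in w-corner
  ... | false = refl
  ... | true with corner-elim w-corner
  ...   | _ , z , c = contradiction (maximal z (StrictlyCorners.member c))
                                    (<⇒≱ (cornered-degree< c))

  non-corner-exists : ∀ {S d} → S d ≡ true → ∃ λ w → S w ≡ true × isCorner G S w ≡ false
  non-corner-exists {S} {d} sd = top , top∈S , max-degree-not-corner top-maximal
    where
    S? : (u : Fin n) → Dec (S u ≡ true)
    S? u = S u ≟ᵇ true
    members : List (Fin n)
    members = filter S? (allFin n)
    top : Fin n
    top = argmax (degree S) d members
    top∈S : S top ≡ true
    top∈S = argmax-all (degree S) sd (all-filter S? (allFin n))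
    top-maximal : ∀ u → S u ≡ true → degree S u ≤ degree S top
    top-maximal u su = All.lookup (f[xs]≤f[argmax] d members) (∈-filter⁺ S? (∈-allFin u) su)

  -- If G^(k) = T is not a clique and has a single strict corner v, then
  -- G^(k+1) = T - v is not a clique either: otherwise the vertex w
  -- cornering v dominates T, some u ∈ T is not adjacent to v (T is not a
  -- clique but T - v is), and w would strictly corner u ≠ v as well.
  unique-corner-leaves-non-clique : ∀ {T v} → isClique G T ≡ false → isCorner G T v ≡ true →
                                    (∀ x → isCorner G T x ≡ true → x ≡ v) →
                                    ¬ isClique G (step T) ≡ true
  unique-corner-leaves-non-clique {T} {v} notClique v-corner unique clique′ =
    u≢v (unique u u-corner)
    where
    tv : T v ≡ true
    tv = proj₁ (corner-elim {T} {v} v-corner)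
    w : Fin n
    w = proj₁ (proj₂ (corner-elim {T} {v} v-corner))
    open StrictlyCorners (proj₂ (proj₂ (corner-elim {T} {v} v-corner)))

    survivor : ∀ {x} → T x ≡ true → x ≢ v → step T x ≡ true
    survivor {x} tx x≢v with isCorner G T x in x-corner
    ... | true  = contradiction (unique x x-corner) x≢v
    ... | false = ∧-intro tx refl

    w≢v : w ≢ v
    w≢v w≡v = not-¬ (subst (λ z → subN G T v z ≡ true) w≡v below)
                    (subst (λ z → subN G T z v ≡ false) w≡v proper)

    w-dominates : ∀ {x} → T x ≡ true → adj G w x ≡ true
    w-dominates {x} tx with x ≟ᶠ v
    ... | yes refl =
      ∧-conicalʳ _ _ (⊆N-elim {T} {v} {w} {v} below (∧-intro tv (Graph.refl G v)))
    ... | no x≢v   = clique-adj clique′ (survivor member w≢v) (survivor tx x≢v)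

    v-non-neighbour : ∃ λ u → T u ≡ true × adj G v u ≡ false
    v-non-neighbour with non-clique-pair notClique
    ... | a , b , ta , tb , ¬ab with a ≟ᶠ v | b ≟ᶠ v
    ...   | yes refl | _        = b , tb , ¬ab
    ...   | no _     | yes refl = a , ta , trans (Graph.sym G v a) ¬ab
    ...   | no a≢v   | no b≢v   =
      contradiction ¬ab (not-¬ (clique-adj clique′ (survivor ta a≢v) (survivor tb b≢v)))

    u : Fin n
    u = proj₁ v-non-neighbour
    tu : T u ≡ true
    tu = proj₁ (proj₂ v-non-neighbour)
    ¬vu : adj G v u ≡ false
    ¬vu = proj₂ (proj₂ v-non-neighbour)

    u≢v : u ≢ v
    u≢v u≡v = not-¬ (Graph.refl G v) (subst (λ z → adj G v z ≡ false) u≡v ¬vu)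

    w-corners-u : StrictlyCorners T w u
    w-corners-u = record
      { member = member
      ; below  = ⊆N-intro λ x ux →
          ∧-intro (∧-conicalˡ _ _ ux) (w-dominates (∧-conicalˡ _ _ ux))
      ; proper = ¬-not λ w⊆u →
          not-¬ (∧-conicalʳ _ _ (⊆N-elim {T} {w} {u} {v} w⊆u (∧-intro tv (w-dominates tv))))
                (trans (Graph.sym G u v) ¬vu)
      }

    u-corner : isCorner G T u ≡ true
    u-corner = corner-intro tu w-corners-u

module Ranking {n : ℕ} (G : Graph n) where
  open Rounds G

  -- S is the vertex set of G^(k): ranks of its vertices are computed from S.
  AtLevel : ℕ → ℕ → VSet n → Set
  AtLevel f k S = ∀ u → S u ≡ true → rank G u ≡ rankFrom G f k S u

  rankFrom-corner : ∀ {f k S v} → isClique G S ≡ false → hasCorner G S ≡ true →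
                    isCorner G S v ≡ true → rankFrom G (suc f) k S v ≡ fin k
  rankFrom-corner notClique cornered corner rewrite notClique | cornered | corner = refl

  rankFrom-next : ∀ {f k S v} → isClique G S ≡ false → hasCorner G S ≡ true →
                  isCorner G S v ≡ false →
                  rankFrom G (suc f) k S v ≡ rankFrom G f (suc k) (step S) v
  rankFrom-next notClique cornered notCorner rewrite notClique | cornered | notCorner = refl

  rankFrom-≥-level : ∀ f k S v {r} → rankFrom G f k S v ≡ fin r → k ≤ r
  rankFrom-≥-level zero k S v ()
  rankFrom-≥-level (suc f) k S v h with isClique G S | hasCorner G S | isCorner G S v
  ... | true  | _     | _     = ≤-reflexive (fin-injective h)
  ... | false | true  | true  = ≤-reflexive (fin-injective h)
  ... | false | true  | false = ≤-trans (n≤1+n k) (rankFrom-≥-level f (suc k) _ v h)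
  rankFrom-≥-level (suc f) k S v () | false | false | _

  record Survives (f k : ℕ) (S : VSet n) (v : Fin n) (r : ℕ) : Set where
    field
      notClique : isClique G S ≡ false
      cornered  : hasCorner G S ≡ true
      notCorner : isCorner G S v ≡ false
      next      : rankFrom G f (suc k) (step S) v ≡ fin r

  survives : ∀ f k S v {r} → rankFrom G (suc f) k S v ≡ fin r → k < r → Survives f k S v r
  survives f k S v h k<r with isClique G S in e₁ | hasCorner G S in e₂ | isCorner G S v in e₃
  ... | true  | _     | _     = contradiction (fin-injective h) (<⇒≢ k<r)
  ... | false | true  | true  = contradiction (fin-injective h) (<⇒≢ k<r)
  ... | false | true  | false = record { notClique = e₁ ; cornered = e₂ ; notCorner = e₃ ; next = h }
  survives f k S v () k<r | false | false | _

  at-next-level : ∀ {f k S} → AtLevel (suc f) k S → isClique G S ≡ false → hasCorner G S ≡ true →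
                  AtLevel f (suc k) (step S)
  at-next-level {f} {S = S} at notClique cornered u su =
    trans (at u (∧-conicalˡ _ _ su))
          (rankFrom-next {f} notClique cornered (not-injective (∧-conicalʳ (S u) _ su)))

  record Reached (j : ℕ) (v : Fin n) (r : ℕ) : Set where
    field
      fuel     : ℕ
      vertices : VSet n
      atLevel  : AtLevel fuel j vertices
      present  : vertices v ≡ true
      rankThen : rankFrom G fuel j vertices v ≡ fin r

  descend : ∀ f k S v {j r} → AtLevel f k S → S v ≡ true → rankFrom G f k S v ≡ fin r →
            k ≤ j → j < r → Reached j v r
  descend zero k S v at sv () k≤j j<r
  descend (suc f) k S v at sv h k≤j j<r with m≤n⇒m<n∨m≡n k≤j
  ... | inj₂ refl =
    record { fuel = suc f ; vertices = S ; atLevel = at ; present = sv ; rankThen = h }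
  ... | inj₁ k<j  =
    descend f (suc k) (step S) v (at-next-level {f} at notClique cornered)
            (∧-intro sv (cong not notCorner)) next k<j j<r
    where open Survives (survives f k S v h (<-trans k<j j<r))

  corner-rank : ∀ {f k S x} → AtLevel (suc f) k S → isClique G S ≡ false → hasCorner G S ≡ true →
                isCorner G S x ≡ true → rank G x ≡ fin k
  corner-rank {f} {k} {S} {x} at notClique cornered corner =
    trans (at x (proj₁ (corner-elim {S} {x} corner)))
          (rankFrom-corner {f} notClique cornered corner)

  finite⇒cornered : ∀ f k S v {r} → rankFrom G (suc f) k S v ≡ fin r →
                    isClique G S ≡ false → hasCorner G S ≡ true
  finite⇒cornered f k S v h notClique rewrite notClique with hasCorner G S
  ... | true = refl
  finite⇒cornered f k S v () notClique | false

  non-corner-rank-exceeds : ∀ f k S w {r} → isClique G S ≡ false → isCorner G S w ≡ false →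
                            rankFrom G f k S w ≡ fin r → k < r
  non-corner-rank-exceeds zero    k S w notClique notCorner ()
  non-corner-rank-exceeds (suc f) k S w notClique notCorner h =
    rankFrom-≥-level f (suc k) (step S) w
      (trans (sym (rankFrom-next {f} notClique (finite⇒cornered f k S w h notClique) notCorner)) h)

  non-clique-rank-exceeds : ∀ {f k S d} → AtLevel f k S → S d ≡ true → isClique G S ≡ false →
                            ∃ λ w → S w ≡ true × (∀ {r} → rank G w ≡ fin r → k < r)
  non-clique-rank-exceeds {f} {k} {S} at sd notClique with non-corner-exists sd
  ... | w , sw , notCorner =
    w , sw , λ rank≡r →
      non-corner-rank-exceeds f k S w notClique notCorner (trans (sym (at w sw)) rank≡r)

  rank-count-one : ∀ {k} → countRank G k ≡ 1 →
                   ∀ x y → rank G x ≡ fin k → rank G y ≡ fin k → x ≡ y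
  rank-count-one {k} count x y rx ry =
    at-most-one-positive (λ v → indicator (isRank (rank G v) k)) (≤-reflexive count)
      (∈-allFin x) (∈-allFin y) (counted rx) (counted ry)
    where
    counted : ∀ {v} → rank G v ≡ fin k → 0 < indicator (isRank (rank G v) k)
    counted rv rewrite rv | to T-≡ (≡⇒≡ᵇ k k refl) = s≤s z≤n

  -- A vertex v₀ of rank K + 1 present at level K
  -- forces the unique strict corner of G^(K) to leave a non-clique
  -- G^(K+1), which keeps a vertex of rank > K + 1: impossible.
  unique-penultimate-rank-impossible :
    ∀ K {v₀} → (∀ u → ∃ λ r → rank G u ≡ fin r × r ≤ suc K) →
    (∀ x y → rank G x ≡ fin K → rank G y ≡ fin K → x ≡ y) →
    ∀ f T → AtLevel f K T → T v₀ ≡ true → rankFrom G f K T v₀ ≡ fin (suc K) → ⊥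
  unique-penultimate-rank-impossible K bounded unique zero T at tv₀ ()
  unique-penultimate-rank-impossible K {v₀} bounded unique (suc f) T at tv₀ h =
    <⇒≱ (exceeds rank-w) r≤α
    where
    open Survives (survives f K T v₀ h ≤-refl)

    unique-corner : ∀ x y → isCorner G T x ≡ true → isCorner G T y ≡ true → x ≡ y
    unique-corner x y cx cy =
      unique x y (corner-rank {f} at notClique cornered cx)
               (corner-rank {f} at notClique cornered cy)

    v : Fin n
    v = proj₁ (any-elim (isCorner G T) cornered)
    v-corner : isCorner G T v ≡ true
    v-corner = proj₂ (any-elim (isCorner G T) cornered)

    next-not-clique : isClique G (step T) ≡ false
    next-not-clique = ¬-not (unique-corner-leaves-non-clique notClique v-corner
                                                              (λ x cx → unique-corner x v cx v-corner))

    high : ∃ λ w → step T w ≡ true × (∀ {r} → rank G w ≡ fin r → suc K < r)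
    high = non-clique-rank-exceeds {f} (at-next-level {f} at notClique cornered)
                                   (∧-intro tv₀ (cong not notCorner)) next-not-clique
    w : Fin n
    w = proj₁ high
    exceeds : ∀ {r} → rank G w ≡ fin r → suc K < r
    exceeds = proj₂ (proj₂ high)
    r : ℕ
    r = proj₁ (bounded w)
    rank-w : rank G w ≡ fin r
    rank-w = proj₁ (proj₂ (bounded w))
    r≤α : r ≤ suc K
    r≤α = proj₂ (proj₂ (bounded w))

open Ranking using (Reached; descend; rank-count-one; unique-penultimate-rank-impossible)

corollary3p19 : (xα : ℕ) (rest : List ℕ) → ¬ Realizable (xα ∷ 1 ∷ rest)
-- For α ≤ 1 the rank cardinality vector has fewer than two entries.
corollary3p19 xα rest (_ , n , G , zero , _ , ())
corollary3p19 xα rest (_ , n , G , suc zero , _ , ())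
corollary3p19 xα rest (_ , n , G , suc (suc m) , max≡α , vector) =
  unique-penultimate-rank-impossible G (suc m) bounded unique fuel vertices atLevel present rankThen
  where
  attained : ∃ λ v₀ → rank G v₀ ≡ fin (suc (suc m))
  attained = maxRank-attained (rank G) (allFin (suc n)) max≡α
  bounded : ∀ u → ∃ λ r → rank G u ≡ fin r × r ≤ suc (suc m)
  bounded u = maxRank-bounds (rank G) (allFin (suc n)) max≡α (∈-allFin u)
  unique : ∀ x y → rank G x ≡ fin (suc m) → rank G y ≡ fin (suc m) → x ≡ y
  unique = rank-count-one G (∷-injectiveˡ (∷-injectiveʳ vector))
  open Reached (descend G (suc n) 1 (λ _ → true) (proj₁ attained) (λ _ _ → refl) refl
                        (proj₂ attained) (s≤s z≤n) ≤-refl)
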